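{- Let $\mathbf A$ be a finite symmetric relation algebra with a normal representation such that $\mathbf A$ has all $1$-cycles and admits a Siggers behavior; let $R\subseteq A_0^3$ be the set of allowed triples and $\mathfrak A_0$ the atom structure of $\mathbf A$. Let $a,b\in A_0$ with $(a,a,b)\notin R$. Then $(a,b)$ is a semilattice edge of $\mathfrak A_0$ but $(b,a)$ is not.
   Context: $\mathbf A=(A;\cup,\bar{\ },0,1,\mathrm{id},\breve{\ },\circ)$ is a relation algebra (Tarski's axioms), symmetric if $\breve a=a$ for all $a$; $A_0$ is its set of atoms. A triple $(x,y,z)\in A_0^3$ is allowed if $z\le x\circ y$. $\mathbf A$ has all $1$-cycles if $(a,a,a)$ is allowed for all $a$. $\mathbf A$ admits a Siggers behavior if there is $s\colon A_0^6\to A_0$ preserving the allowed triples, with $s(x_1,\dots,x_6)\in\{x_1,\dots,x_6\}$ and $s(x,x,y,y,z,z)=s(y,z,x,z,x,y)$. A normal representation is a representation that is square, homogeneous and fully universal (every atomic closed network is satisfiable in it). The atom structure $\mathfrak A_0$ has domain $A_0$, a unary relation $\{a\in A_0\mid a\le x\}$ for each $x\in A$ (so every subset of $A_0$), the binary relation $\{(a_1,a_2)\mid \breve{a_1}=a_2\}$, and the ternary relation $R$. A polymorphism of $\mathfrak A_0$ is an operation $A_0^n\to A_0$ preserving all its relations componentwise. A pair $(a,b)$ is a semilattice edge of $\mathfrak A_0$ if there is a binary polymorphism $p$ with $p(a,b)=p(b,a)=p(b,b)=b$ and $p(a,a)=a$. -}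

module Defs where

open import Data.Nat using (ℕ)
open import Data.Fin using (Fin)
open import Data.Vec using (Vec; []; _∷_; lookup)
open import Data.Product using (Σ; ∃; _×_; _,_; proj₁)
open import Data.Sum using (_⊎_)
open import Relation.Nullary using (¬_)
open import Relation.Binary.PropositionalEquality using (_≡_; _≢_)
open import Function.Bundles using (_⇔_; _↔_; Inverse)

record RelationAlgebra : Set₁ where
  infixl 6 _∪_
  infixl 7 _∘_
  field
    Carrier : Set
    _∪_     : Carrier → Carrier → Carrier
    ∁       : Carrier → Carrier
    zero    : Carrier
    one     : Carrier
    idA     : Carrier
    conv    : Carrier → Carrier
    _∘_     : Carrier → Carrier → Carrier
    ∪-comm     : ∀ x y → x ∪ y ≡ y ∪ x
    ∪-assoc    : ∀ x y z → x ∪ (y ∪ z) ≡ (x ∪ y) ∪ z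
    huntington : ∀ x y → ∁ (∁ x ∪ y) ∪ ∁ (∁ x ∪ ∁ y) ≡ x
    one-def    : ∀ x → one ≡ x ∪ ∁ x
    zero-def   : zero ≡ ∁ one
    ∘-assoc    : ∀ x y z → x ∘ (y ∘ z) ≡ (x ∘ y) ∘ z
    ∘-distribʳ : ∀ x y z → (x ∪ y) ∘ z ≡ (x ∘ z) ∪ (y ∘ z)
    ∘-idʳ      : ∀ x → x ∘ idA ≡ x
    conv-invol : ∀ x → conv (conv x) ≡ x
    conv-∪     : ∀ x y → conv (x ∪ y) ≡ conv x ∪ conv y
    conv-∘     : ∀ x y → conv (x ∘ y) ≡ conv y ∘ conv x
    tarski     : ∀ x y → (conv x ∘ ∁ (x ∘ y)) ∪ ∁ y ≡ ∁ y

module RA (𝐀 : RelationAlgebra) where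
  open RelationAlgebra 𝐀 public

  _≤_ : Carrier → Carrier → Set
  x ≤ y = x ∪ y ≡ y

  IsAtom : Carrier → Set
  IsAtom a = a ≢ zero × (∀ x → x ≤ a → x ≡ zero ⊎ x ≡ a)

  Atom : Set
  Atom = Σ Carrier IsAtom

  Allowed : Atom → Atom → Atom → Set
  Allowed x y z = proj₁ z ≤ (proj₁ x ∘ proj₁ y)

  _≈_ : Atom → Atom → Set
  a ≈ b = proj₁ a ≡ proj₁ b

  IsFinite : Set
  IsFinite = Σ ℕ λ n → Carrier ↔ Fin n

  IsSymmetric : Set
  IsSymmetric = ∀ x → conv x ≡ x

  HasAll1Cycles : Set
  HasAll1Cycles = ∀ a → Allowed a a a

  IsSiggersBehavior : (Vec Atom 6 → Atom) → Set
  IsSiggersBehavior s =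
      (∀ xs ys zs → (∀ i → Allowed (lookup xs i) (lookup ys i) (lookup zs i))
                  → Allowed (s xs) (s ys) (s zs))
    × (∀ xs → ∃ λ i → s xs ≈ lookup xs i)
    × (∀ x y z → s (x ∷ x ∷ y ∷ y ∷ z ∷ z ∷ []) ≈ s (y ∷ z ∷ x ∷ z ∷ x ∷ y ∷ []))

  AdmitsSiggersBehavior : Set
  AdmitsSiggersBehavior = Σ (Vec Atom 6 → Atom) IsSiggersBehavior

  -- The atom structure 𝔄₀ and its binary polymorphisms.
  -- Relations: for every x ∈ A the unary relation {a ∈ A₀ ∣ a ≤ x};
  -- the binary relation {(a₁,a₂) ∣ a₁˘ = a₂}; the ternary relation R.

  IsBinaryPolymorphism : (Atom → Atom → Atom) → Set
  IsBinaryPolymorphism p =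
      (∀ x a₁ a₂ → proj₁ a₁ ≤ x → proj₁ a₂ ≤ x → proj₁ (p a₁ a₂) ≤ x)
    × (∀ a₁ a₂ b₁ b₂ → conv (proj₁ a₁) ≡ proj₁ b₁ → conv (proj₁ a₂) ≡ proj₁ b₂
                     → conv (proj₁ (p a₁ a₂)) ≡ proj₁ (p b₁ b₂))
    × (∀ x₁ x₂ y₁ y₂ z₁ z₂ → Allowed x₁ y₁ z₁ → Allowed x₂ y₂ z₂
                           → Allowed (p x₁ x₂) (p y₁ y₂) (p z₁ z₂))

  IsSemilatticeEdge : Atom → Atom → Set
  IsSemilatticeEdge a b = Σ (Atom → Atom → Atom) λ p →
    IsBinaryPolymorphism p
    × p a b ≈ b × p b a ≈ b × p b b ≈ b × p a a ≈ a

  -- Square representations: an embedding of 𝐀 into the full relation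
  -- algebra on D × D (the unit 1 is represented by D × D).

  record Representation : Set₁ where
    field
      D    : Set
      rel  : Carrier → D → D → Set
      rel-∪    : ∀ x y u v → rel (x ∪ y) u v ⇔ (rel x u v ⊎ rel y u v)
      rel-∁    : ∀ x u v → rel (∁ x) u v ⇔ (¬ rel x u v)
      rel-zero : ∀ u v → ¬ rel zero u v
      rel-one  : ∀ u v → rel one u v
      rel-id   : ∀ u v → rel idA u v ⇔ (u ≡ v)
      rel-conv : ∀ x u v → rel (conv x) u v ⇔ rel x v u
      rel-∘    : ∀ x y u v → rel (x ∘ y) u v ⇔ (∃ λ w → rel x u w × rel y w v)
      rel-injective : ∀ x y → (∀ u v → rel x u v ⇔ rel y u v) → x ≡ y

    IsAutomorphism : D ↔ D → Set
    IsAutomorphism σ = ∀ x u v → rel x u v ⇔ rel x (Inverse.to σ u) (Inverse.to σ v)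

    -- every isomorphism between finite substructures (given as the map
    -- u i ↦ v i) extends to an automorphism
    IsHomogeneous : Set
    IsHomogeneous = ∀ (k : ℕ) (u v : Fin k → D)
      → (∀ i j x → rel x (u i) (u j) ⇔ rel x (v i) (v j))
      → Σ (D ↔ D) λ σ → IsAutomorphism σ × (∀ i → Inverse.to σ (u i) ≡ v i)

    -- every atomic closed network is satisfiable
    IsFullyUniversal : Set
    IsFullyUniversal = ∀ (k : ℕ) (λ′ : Fin k → Fin k → Atom)
      → (∀ i → proj₁ (λ′ i i) ≤ idA)
      → (∀ i j → proj₁ (λ′ j i) ≡ conv (proj₁ (λ′ i j)))
      → (∀ i j l → Allowed (λ′ i j) (λ′ j l) (λ′ i l))
      → Σ (Fin k → D) λ f → ∀ i j → rel (proj₁ (λ′ i j)) (f i) (f j)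

    IsNormal : Set
    IsNormal = IsHomogeneous × IsFullyUniversal

  HasNormalRepresentation : Set₁
  HasNormalRepresentation = Σ Representation Representation.IsNormal

-- Call atoms (c, d) a join pair if d ≤ c ∘ d but d ≰ c ∘ c: a triple over {c, d} is then allowed
-- iff it does not contain d exactly once. For a conservative polymorphism f, the coordinate sets P
-- that f misses (the tuple with d on P and c elsewhere is sent to c) are therefore closed under
-- unions and subsets, and the full set is not missed.
-- If b ≰ a ∘ b, then (id, a) and (id, b) are join pairs and a ∘ b contains neither a nor b, so the
-- Siggers behaviour s cannot hit P on {id, a} and the complement of P on {id, b}. The Siggers
-- identity makes s miss {1,2} iff {3,5}, {3,4} iff {1,6}, {5,6} iff {2,4}; on {id, a} it hits one of
-- the covering sets {1,2}, {3,4}, {5,6}, hence two disjoint sets, and then it misses everything on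
-- {id, b}. So (a, b) is a join pair, and the same identities show that on {a, b} s hits both
-- {3,4,5} and {1,2,6}: p(x, y) = s(x, x, y, y, y, x) is a semilattice polymorphism with
-- p(a, b) = p(b, a) = b. Conversely, a semilattice edge (b, a) would map the allowed triples
-- (a, b, b), (b, a, b) to (a, a, b).
module Submission where

open import Defs
open import Data.Bool using (Bool; true; false; if_then_else_; _∨_; not)
open import Data.Empty using (⊥; ⊥-elim)
open import Data.Fin.Properties using (inj⇒≟)
open import Data.Fin.Subset using (Subset; inside; outside)
import Data.Fin.Subset as Sub
open import Data.Fin.Subset.Properties using (∪-comm)
open import Data.Product using (_×_; ∃; _,_; proj₁; proj₂)
open import Data.Sum using (_⊎_; inj₁; inj₂; [_,_]; [_,_]′)
open import Data.Vec using (Vec; []; _∷_; lookup; map)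
open import Data.Vec.Properties using (lookup-map; lookup-zipWith; lookup-replicate; map-∘)
open import Data.Vec.Relation.Binary.Pointwise.Inductive
  using (Pointwise; Pointwise-≡⇒≡; ≡⇒Pointwise-≡) renaming (map⁺ to Pointwise-map⁺)
open import Function.Bundles using (Equivalence; mk⇔)
open import Function.Properties.Inverse using (↔⇒↣)
open import Relation.Binary.Definitions using (DecidableEquality)
open import Relation.Binary.PropositionalEquality
  using (_≡_; _≢_; refl; sym; trans; cong; cong₂; subst; module ≡-Reasoning)
open import Relation.Nullary using (¬_; Dec; yes; no)
open import Relation.Nullary.Decidable using (decidable-stable; recompute; _⊎-dec_)
open import Relation.Nullary.Recomputable
  using (Recomputable; ¬-recompute; _×-recompute_; Π-recompute; _→-recompute_)

open Equivalence using (to; from)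

module AtomOperations (𝐀 : RelationAlgebra) where
  open RA 𝐀

  Allowed-cong : ∀ {x x′ y y′ z z′ : Carrier}
    → x ≡ x′ → y ≡ y′ → z ≡ z′ → z ≤ (x ∘ y) → z′ ≤ (x′ ∘ y′)
  Allowed-cong refl refl refl xyz = xyz

  Conservative : ∀ {n} → (Vec Atom n → Atom) → Set
  Conservative f = ∀ xs → ∃ λ i → f xs ≈ lookup xs i

  PreservesAllowed : ∀ {n} → (Vec Atom n → Atom) → Set
  PreservesAllowed f = ∀ xs ys zs → (∀ i → Allowed (lookup xs i) (lookup ys i) (lookup zs i))
                     → Allowed (f xs) (f ys) (f zs)

  Congruent : ∀ {n} → (Vec Atom n → Atom) → Set
  Congruent f = ∀ {xs ys} → Pointwise _≈_ xs ys → f xs ≈ f ys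

  select : Atom → Atom → Bool → Atom
  select x y b = if b then y else x

module SymmetricRepresentation (𝐀 : RelationAlgebra) (finite : RA.IsFinite 𝐀)
  (symmetric : RA.IsSymmetric 𝐀) (ρ : RA.Representation 𝐀) where
  open RA 𝐀
  open Representation ρ

  _≟_ : DecidableEquality Carrier
  _≟_ = inj⇒≟ (↔⇒↣ (proj₂ finite))

  ≡-stable : ∀ {x y} → ¬ ¬ x ≡ y → x ≡ y
  ≡-stable {x} {y} = decidable-stable (x ≟ y)

  Allowed? : ∀ x y z → Dec (Allowed x y z)
  Allowed? (x , _) (y , _) (z , _) = (z ∪ (x ∘ y)) ≟ (x ∘ y)

  isAtom-recompute : ∀ c → Recomputable (IsAtom c)
  isAtom-recompute c =
    ¬-recompute ×-recompute
    Π-recompute _ (λ x → _ →-recompute recompute ((x ≟ zero) ⊎-dec (x ≟ c)))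

  -- The atomhood proof is recomputed from an irrelevant argument, so it depends on proj₁ x only.
  canonical : Atom → Atom
  canonical (c , c-atom) = c , isAtom-recompute c c-atom

  canonical-cong : ∀ {x y} → x ≈ y → canonical x ≡ canonical y
  canonical-cong {_ , _} {_ , _} refl = refl

  rel-mono : ∀ {x y u v} → x ≤ y → rel x u v → rel y u v
  rel-mono {x} {y} {u} {v} x≤y r = subst (λ t → rel t u v) x≤y (from (rel-∪ x y u v) (inj₁ r))

  ≤-by-rel : ∀ {x y} → (∀ {u v} → rel x u v → rel y u v) → x ≤ y
  ≤-by-rel {x} {y} x⊆y = rel-injective _ _ λ u v →
    mk⇔ (λ r → [ x⊆y , (λ r′ → r′) ] (to (rel-∪ x y u v) r))
        (λ r → from (rel-∪ x y u v) (inj₂ r))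

  ≤-refl : ∀ {x} → x ≤ x
  ≤-refl = ≤-by-rel (λ r → r)

  rel-dichotomy : ∀ x u v → rel x u v ⊎ ¬ rel x u v
  rel-dichotomy x u v
    with to (rel-∪ x (∁ x) u v) (subst (λ t → rel t u v) (one-def x) (rel-one u v))
  ... | inj₁ r = inj₁ r
  ... | inj₂ r = inj₂ (to (rel-∁ x u v) r)

  rel-nonempty : ∀ {x} → x ≢ zero → ¬ (∀ u v → ¬ rel x u v)
  rel-nonempty {x} x≢0 empty = x≢0 (rel-injective x zero λ u v →
    mk⇔ (λ r → ⊥-elim (empty u v r)) (λ r → ⊥-elim (rel-zero u v r)))

  _⊓_ : Carrier → Carrier → Carrier
  x ⊓ y = ∁ (∁ x ∪ ∁ y)

  rel-⊓⁺ : ∀ {x y u v} → rel x u v → rel y u v → rel (x ⊓ y) u v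
  rel-⊓⁺ {x} {y} {u} {v} rx ry = from (rel-∁ _ u v) λ r →
    [ (λ r∁x → to (rel-∁ x u v) r∁x rx) , (λ r∁y → to (rel-∁ y u v) r∁y ry) ]
      (to (rel-∪ (∁ x) (∁ y) u v) r)

  rel-⊓⁻ : ∀ {x y u v} → rel (x ⊓ y) u v → rel x u v × rel y u v
  rel-⊓⁻ {x} {y} {u} {v} r = recover x inj₁ , recover y inj₂
    where
    recover : ∀ z → (rel (∁ z) u v → rel (∁ x) u v ⊎ rel (∁ y) u v) → rel z u v
    recover z into with rel-dichotomy z u v
    ... | inj₁ rz = rz
    ... | inj₂ ¬rz =
      ⊥-elim (to (rel-∁ _ u v) r (from (rel-∪ _ _ u v) (into (from (rel-∁ z u v) ¬rz))))

  atom-≤ : ∀ {z w u v} → IsAtom z → rel z u v → rel w u v → z ≤ w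
  atom-≤ {z} {w} {u} {v} (_ , z-atom) rz rw
    with z-atom (z ⊓ w) (≤-by-rel (λ r → proj₁ (rel-⊓⁻ r)))
  ... | inj₁ z⊓w≡0 = ⊥-elim (rel-zero u v (subst (λ t → rel t u v) z⊓w≡0 (rel-⊓⁺ rz rw)))
  ... | inj₂ z⊓w≡z =
    ≤-by-rel (λ {u′} {v′} r → proj₂ (rel-⊓⁻ (subst (λ t → rel t u′ v′) (sym z⊓w≡z) r)))

  rel-sym : ∀ {x u v} → rel x u v → rel x v u
  rel-sym {x} {u} {v} r = subst (λ t → rel t v u) (symmetric x) (from (rel-conv x v u) r)

  ∘-comm : ∀ x y → x ∘ y ≡ y ∘ x
  ∘-comm x y = begin
    x ∘ y            ≡⟨ sym (symmetric (x ∘ y)) ⟩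
    conv (x ∘ y)     ≡⟨ conv-∘ x y ⟩
    conv y ∘ conv x  ≡⟨ cong₂ _∘_ (symmetric y) (symmetric x) ⟩
    y ∘ x            ∎
    where open ≡-Reasoning

  ∘-idˡ : ∀ x → idA ∘ x ≡ x
  ∘-idˡ x = trans (∘-comm idA x) (∘-idʳ x)

  Allowed-swap : ∀ {x y z : Carrier} → z ≤ (x ∘ y) → z ≤ (y ∘ x)
  Allowed-swap {x} {y} {z} = subst (z ≤_) (∘-comm x y)

  -- A triangle (u, w, v) of the representation witnessing z ≤ x ∘ y, read from w, witnesses
  -- y ≤ x ∘ z; one witness suffices for an atom.
  Allowed-rotate : ∀ x y z → Allowed x y z → Allowed x z y
  Allowed-rotate (x , _) (y , y-atom) (z , z≢0 , _) z≤xy =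
    ≡-stable λ y≰xz → rel-nonempty z≢0 λ u v rz →
    let (w , rx , ry) = to (rel-∘ x y u v) (rel-mono z≤xy rz)
    in y≰xz (atom-≤ y-atom ry (from (rel-∘ x z w v) (u , rel-sym rx , rz)))

  id≢zero : Atom → idA ≢ zero
  id≢zero (_ , a≢0 , _) id≡0 = rel-nonempty a≢0 λ u v _ →
    rel-zero v v (subst (λ t → rel t v v) id≡0 (from (rel-id v v) refl))

  subidentity-total : ∀ {x u} → x ≤ idA → rel x u u → ∀ w → rel x w w
  subidentity-total {x} {u} x≤id ruu w
    with to (rel-∘ x one w u) (rel-sym (from (rel-∘ x one u w) (u , ruu , rel-one u w)))
  ... | p , rwp , _ = subst (rel x w) (sym (to (rel-id w p) (rel-mono x≤id rwp))) rwp

  subidentity : ∀ {x} → x ≢ zero → x ≤ idA → x ≡ idA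
  subidentity {x} x≢0 x≤id = ≡-stable λ x≢id → rel-nonempty x≢0 λ u v ruv →
    let ruu = subst (rel x u) (sym (to (rel-id u v) (rel-mono x≤id ruv))) ruv
    in x≢id (rel-injective x idA λ w w′ → mk⇔ (rel-mono x≤id)
         (λ r → subst (rel x w) (to (rel-id w w′) r) (subidentity-total x≤id ruu w)))

  id-isAtom : Atom → IsAtom idA
  id-isAtom a = id≢zero a , below-id
    where
    below-id : ∀ x → x ≤ idA → x ≡ zero ⊎ x ≡ idA
    below-id x x≤id with x ≟ zero
    ... | yes x≡0 = inj₁ x≡0
    ... | no x≢0 = inj₂ (subidentity x≢0 x≤id)

  idAtom : Atom → Atom
  idAtom a = idA , id-isAtom a

  Allowed-idˡ : ∀ a x → Allowed (idAtom a) x x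
  Allowed-idˡ a (x , _) = subst (x ≤_) (sym (∘-idˡ x)) ≤-refl

  Allowed-id-diagonal : ∀ a x → Allowed x x (idAtom a)
  Allowed-id-diagonal a (x , x≢0 , _) = ≡-stable λ id≰xx → rel-nonempty x≢0 λ u v r →
    id≰xx (atom-≤ (id-isAtom a) (from (rel-id u u) refl)
                  (from (rel-∘ x x u u) (v , r , rel-sym r)))

  ¬Allowed-id-id : ∀ a x → ¬ x ≈ idAtom a → ¬ Allowed (idAtom a) (idAtom a) x
  ¬Allowed-id-id a (x , x≢0 , _) x≢id x≤idid
    with proj₂ (id-isAtom a) x (subst (x ≤_) (∘-idʳ idA) x≤idid)
  ... | inj₁ x≡0 = x≢0 x≡0
  ... | inj₂ x≡id = x≢id x≡id

module Polymorphisms (𝐀 : RelationAlgebra) (finite : RA.IsFinite 𝐀)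
  (symmetric : RA.IsSymmetric 𝐀) (ρ : RA.Representation 𝐀) (cycles : RA.HasAll1Cycles 𝐀) where
  open RA 𝐀 hiding (∪-comm)
  open AtomOperations 𝐀
  open SymmetricRepresentation 𝐀 finite symmetric ρ

  module OnOperation {n} (f : Vec Atom n → Atom)
    (f-conservative : Conservative f) (f-preserves : PreservesAllowed f) where

    conservative-map : (Q : Carrier → Set) → ∀ {A : Set} (g : A → Atom) (P : Vec A n)
      → (∀ i → Q (proj₁ (g (lookup P i)))) → Q (proj₁ (f (map g P)))
    conservative-map Q g P q with f-conservative (map g P)
    ... | i , fgP≈gPᵢ = subst Q (sym (trans fgP≈gPᵢ (cong proj₁ (lookup-map i g P)))) (q i)

    preserves-map : ∀ {A : Set} (g h k : A → Atom) (P Q R : Vec A n)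
      → (∀ i → Allowed (g (lookup P i)) (h (lookup Q i)) (k (lookup R i)))
      → Allowed (f (map g P)) (f (map h Q)) (f (map k R))
    preserves-map g h k P Q R columns = f-preserves _ _ _ column
      where
      column : ∀ i → Allowed (lookup (map g P) i) (lookup (map h Q) i) (lookup (map k R) i)
      column i rewrite lookup-map i g P | lookup-map i h Q | lookup-map i k R = columns i

    module JoinPair (c d : Atom) (cdd : Allowed c d d) (ccd̸ : ¬ Allowed c c d) where

      χ : Subset n → Vec Atom n
      χ = map (select c d)

      Hits Misses : Subset n → Set
      Hits P = f (χ P) ≈ d
      Misses P = f (χ P) ≈ c

      dcc̸ : ¬ Allowed d c c
      dcc̸ dcc = ccd̸ (Allowed-rotate c d c (Allowed-swap dcc))

      c≉d : ¬ c ≈ d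
      c≉d c≈d = ccd̸ (Allowed-cong refl refl c≈d (cycles c))

      hits⊎misses : ∀ P → Hits P ⊎ Misses P
      hits⊎misses P = conservative-map (λ z → z ≡ proj₁ d ⊎ z ≡ proj₁ c) (select c d) P
        λ i → c-or-d (lookup P i)
        where
        c-or-d : ∀ b → proj₁ (select c d b) ≡ proj₁ d ⊎ proj₁ (select c d b) ≡ proj₁ c
        c-or-d true = inj₁ refl
        c-or-d false = inj₂ refl

      hits-if-¬misses : ∀ {P} → ¬ Misses P → Hits P
      hits-if-¬misses {P} ¬m = [ (λ h → h) , (λ m → ⊥-elim (¬m m)) ]′ (hits⊎misses P)

      ¬misses-⊤ : ¬ Misses Sub.⊤
      ¬misses-⊤ m = c≉d (trans (sym m) hits-⊤)
        where
        hits-⊤ : Hits Sub.⊤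
        hits-⊤ = conservative-map (_≡ proj₁ d) (select c d) Sub.⊤
          λ i → cong (λ b → proj₁ (select c d b)) (lookup-replicate i true)

      misses-∪ : ∀ P Q → Misses P → Misses Q → Misses (P Sub.∪ Q)
      misses-∪ P Q mP mQ with hits⊎misses (P Sub.∪ Q)
      ... | inj₂ m = m
      ... | inj₁ h =
        ⊥-elim (ccd̸ (Allowed-cong mP mQ h (preserves-map _ _ _ P Q (P Sub.∪ Q) column)))
        where
        join : ∀ x y → Allowed (select c d x) (select c d y) (select c d (x ∨ y))
        join false false = cycles c
        join false true = cdd
        join true false = Allowed-swap cdd
        join true true = cycles d
        column : ∀ i → Allowed (select c d (lookup P i)) (select c d (lookup Q i))
                               (select c d (lookup (P Sub.∪ Q) i))
        column i rewrite lookup-zipWith _∨_ i P Q = join (lookup P i) (lookup Q i)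

      misses-∪⁻ˡ : ∀ P Q → Misses (P Sub.∪ Q) → Misses P
      misses-∪⁻ˡ P Q m with hits⊎misses P
      ... | inj₂ mP = mP
      ... | inj₁ h =
        ⊥-elim (dcc̸ (Allowed-cong h m m (preserves-map _ _ _ P (P Sub.∪ Q) (P Sub.∪ Q) column)))
        where
        absorb : ∀ x y → Allowed (select c d x) (select c d (x ∨ y)) (select c d (x ∨ y))
        absorb false false = cycles c
        absorb false true = cdd
        absorb true _ = cycles d
        column : ∀ i → Allowed (select c d (lookup P i)) (select c d (lookup (P Sub.∪ Q) i))
                               (select c d (lookup (P Sub.∪ Q) i))
        column i rewrite lookup-zipWith _∨_ i P Q = absorb (lookup P i) (lookup Q i)

      misses-∪⁻ʳ : ∀ P Q → Misses (P Sub.∪ Q) → Misses Q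
      misses-∪⁻ʳ P Q m = misses-∪⁻ˡ Q P (subst Misses (∪-comm P Q) m)

    module Incompatible (c d₁ d₂ : Atom)
      (cd₁d₁ : Allowed c d₁ d₁) (ccd₁̸ : ¬ Allowed c c d₁)
      (cd₂d₂ : Allowed c d₂ d₂) (ccd₂̸ : ¬ Allowed c c d₂)
      (d₁d₂d₁̸ : ¬ Allowed d₁ d₂ d₁) (d₁d₂d₂̸ : ¬ Allowed d₁ d₂ d₂) where
      private
        module ₁ = JoinPair c d₁ cd₁d₁ ccd₁̸
        module ₂ = JoinPair c d₂ cd₂d₂ ccd₂̸

      ¬hits-complement : ∀ P → ₁.Hits P → ₂.Hits (Sub.∁ P) → ⊥
      ¬hits-complement P h₁ h₂ =
        conservative-map (λ z → ¬ (z ≤ (proj₁ d₁ ∘ proj₁ d₂))) (select d₂ d₁) P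
          (λ i → incompatible (lookup P i))
          (Allowed-cong h₁ h₂′ refl (preserves-map _ _ _ P P P λ i → column (lookup P i)))
        where
        incompatible : ∀ b → ¬ Allowed d₁ d₂ (select d₂ d₁ b)
        incompatible true = d₁d₂d₁̸
        incompatible false = d₁d₂d₂̸
        column : ∀ b → Allowed (select c d₁ b) (select c d₂ (not b)) (select d₂ d₁ b)
        column true = Allowed-swap cd₁d₁
        column false = cd₂d₂
        h₂′ : f (map (λ b → select c d₂ (not b)) P) ≈ d₂
        h₂′ = subst (λ xs → f xs ≈ d₂) (sym (map-∘ (select c d₂) not P)) h₂

      ¬disjoint-hits : ∀ P Q → Sub.∁ P Sub.∪ Sub.∁ Q ≡ Sub.⊤
        → ₁.Hits P → ₁.Hits Q → ⊥
      ¬disjoint-hits P Q cover hP hQ with ₂.hits⊎misses (Sub.∁ P) | ₂.hits⊎misses (Sub.∁ Q)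
      ... | inj₁ h | _ = ¬hits-complement P hP h
      ... | _ | inj₁ h = ¬hits-complement Q hQ h
      ... | inj₂ m | inj₂ m′ = ₂.¬misses-⊤ (subst ₂.Misses cover (₂.misses-∪ _ _ m m′))

    select-idempotent : ∀ x T → f (map (select x x) T) ≈ x
    select-idempotent x T = conservative-map (_≡ proj₁ x) (select x x) T λ i → same (lookup T i)
      where
      same : ∀ b → proj₁ (select x x b) ≡ proj₁ x
      same true = refl
      same false = refl

    binary-polymorphism : Congruent f → ∀ T
      → IsBinaryPolymorphism (λ x y → f (map (select x y) T))
    binary-polymorphism f-congruent T = unary , converse , ternary
      where
      unary : ∀ x a₁ a₂ → proj₁ a₁ ≤ x → proj₁ a₂ ≤ x
        → proj₁ (f (map (select a₁ a₂) T)) ≤ x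
      unary x a₁ a₂ a₁≤x a₂≤x =
        conservative-map (_≤ x) (select a₁ a₂) T λ i → bounded (lookup T i)
        where
        bounded : ∀ b → proj₁ (select a₁ a₂ b) ≤ x
        bounded true = a₂≤x
        bounded false = a₁≤x
      converse : ∀ a₁ a₂ b₁ b₂
        → conv (proj₁ a₁) ≡ proj₁ b₁ → conv (proj₁ a₂) ≡ proj₁ b₂
        → conv (proj₁ (f (map (select a₁ a₂) T))) ≡ proj₁ (f (map (select b₁ b₂) T))
      converse a₁ a₂ b₁ b₂ e₁ e₂ = trans (symmetric _)
        (f-congruent (Pointwise-map⁺ (λ { {b} refl → same b }) (≡⇒Pointwise-≡ {xs = T} refl)))
        where
        same : ∀ b → select a₁ a₂ b ≈ select b₁ b₂ b
        same true = trans (sym (symmetric _)) e₂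
        same false = trans (sym (symmetric _)) e₁
      ternary : ∀ x₁ x₂ y₁ y₂ z₁ z₂ → Allowed x₁ y₁ z₁ → Allowed x₂ y₂ z₂
        → Allowed (f (map (select x₁ x₂) T)) (f (map (select y₁ y₂) T))
                  (f (map (select z₁ z₂) T))
      ternary x₁ x₂ y₁ y₂ z₁ z₂ h₁ h₂ =
        preserves-map _ _ _ T T T λ i → column (lookup T i)
        where
        column : ∀ b → Allowed (select x₁ x₂ b) (select y₁ y₂ b) (select z₁ z₂ b)
        column true = h₂
        column false = h₁

  ¬aab⇒¬semilattice-edge : ∀ {a b} → ¬ Allowed a a b → Allowed a b b
    → ¬ IsSemilatticeEdge b a
  ¬aab⇒¬semilattice-edge {a} {b} aab̸ abb
    (q , (_ , _ , q-preserves) , qba≈a , qab≈a , _ , qbb≈b) =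
    aab̸ (Allowed-cong qab≈a qba≈a qbb≈b (q-preserves a b b a b b abb (Allowed-swap abb)))

  -- Needed because a binary polymorphism must respect ≈ (its converse clause), which s need not.
  canonical-siggers : ∀ {s} → IsSiggersBehavior s
    → IsSiggersBehavior (λ xs → s (map canonical xs))
  canonical-siggers {s} (preserves , conservative , identity) =
    preserves′ , conservative′ , identity′
    where
    lookup-canonical : ∀ {n} (xs : Vec Atom n) i → lookup (map canonical xs) i ≈ lookup xs i
    lookup-canonical xs i = cong proj₁ (lookup-map i canonical xs)
    preserves′ : PreservesAllowed (λ xs → s (map canonical xs))
    preserves′ xs ys zs columns = preserves _ _ _ λ i →
      Allowed-cong (sym (lookup-canonical xs i)) (sym (lookup-canonical ys i))
                   (sym (lookup-canonical zs i)) (columns i)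
    conservative′ : Conservative (λ xs → s (map canonical xs))
    conservative′ xs with conservative (map canonical xs)
    ... | i , e = i , trans e (lookup-canonical xs i)
    identity′ : ∀ x y z → s (map canonical (x ∷ x ∷ y ∷ y ∷ z ∷ z ∷ []))
                        ≈ s (map canonical (y ∷ z ∷ x ∷ z ∷ x ∷ y ∷ []))
    identity′ x y z = identity (canonical x) (canonical y) (canonical z)

  canonical-congruent : ∀ {n} (s : Vec Atom n → Atom) → Congruent (λ xs → s (map canonical xs))
  canonical-congruent s xs≈ys = cong (λ xs → proj₁ (s xs))
    (Pointwise-≡⇒≡ (Pointwise-map⁺ (λ {x} {y} → canonical-cong {x} {y}) xs≈ys))

  siggersˡ siggersʳ : Bool → Bool → Bool → Subset 6
  siggersˡ x y z = x ∷ x ∷ y ∷ y ∷ z ∷ z ∷ []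
  siggersʳ x y z = y ∷ z ∷ x ∷ z ∷ x ∷ y ∷ []

  S₁₂ S₃₅ S₃₄ S₁₆ S₅₆ S₂₄ T₁ T₂ : Subset 6
  S₁₂ = inside ∷ inside ∷ outside ∷ outside ∷ outside ∷ outside ∷ []
  S₃₅ = outside ∷ outside ∷ inside ∷ outside ∷ inside ∷ outside ∷ []
  S₃₄ = outside ∷ outside ∷ inside ∷ inside ∷ outside ∷ outside ∷ []
  S₁₆ = inside ∷ outside ∷ outside ∷ outside ∷ outside ∷ inside ∷ []
  S₅₆ = outside ∷ outside ∷ outside ∷ outside ∷ inside ∷ inside ∷ []
  S₂₄ = outside ∷ inside ∷ outside ∷ inside ∷ outside ∷ outside ∷ []
  T₁ = S₃₅ Sub.∪ S₃₄
  T₂ = S₁₂ Sub.∪ S₁₆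

  module Siggers (s : Vec Atom 6 → Atom) (s-siggers : IsSiggersBehavior s) where
    open OnOperation s (proj₁ (proj₂ s-siggers)) (proj₁ s-siggers) public

    module SiggersPair (c d : Atom) (cdd : Allowed c d d) (ccd̸ : ¬ Allowed c c d) where
      open JoinPair c d cdd ccd̸ public

      siggers-χ : ∀ x y z → s (χ (siggersˡ x y z)) ≈ s (χ (siggersʳ x y z))
      siggers-χ x y z = proj₂ (proj₂ s-siggers) (select c d x) (select c d y) (select c d z)

      misses-siggersˡ : ∀ x y z → Misses (siggersʳ x y z) → Misses (siggersˡ x y z)
      misses-siggersˡ x y z = trans (siggers-χ x y z)

      misses-siggersʳ : ∀ x y z → Misses (siggersˡ x y z) → Misses (siggersʳ x y z)
      misses-siggersʳ x y z = trans (sym (siggers-χ x y z))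

      hits-siggersʳ : ∀ x y z → Hits (siggersˡ x y z) → Hits (siggersʳ x y z)
      hits-siggersʳ x y z = trans (sym (siggers-χ x y z))

    module SemilatticeCase (c d : Atom) (cdd : Allowed c d d) (ccd̸ : ¬ Allowed c c d) where
      open SiggersPair c d cdd ccd̸

      misses-T₁⇒misses-T₂ : Misses T₁ → Misses T₂
      misses-T₁⇒misses-T₂ m = misses-∪ S₁₂ S₁₆
        (misses-siggersˡ true false false (misses-∪⁻ˡ S₃₅ S₃₄ m))
        (misses-siggersʳ false true false (misses-∪⁻ʳ S₃₅ S₃₄ m))

      misses-T₂⇒misses-T₁ : Misses T₂ → Misses T₁
      misses-T₂⇒misses-T₁ m = misses-∪ S₃₅ S₃₄
        (misses-siggersʳ true false false (misses-∪⁻ˡ S₁₂ S₁₆ m))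
        (misses-siggersˡ false true false (misses-∪⁻ʳ S₁₂ S₁₆ m))

      hits-T₁ : Hits T₁
      hits-T₁ = hits-if-¬misses λ m →
        ¬misses-⊤ (misses-∪ T₁ T₂ m (misses-T₁⇒misses-T₂ m))

      hits-T₂ : Hits T₂
      hits-T₂ = hits-if-¬misses λ m →
        ¬misses-⊤ (misses-∪ T₁ T₂ (misses-T₂⇒misses-T₁ m) m)

    module _ (c d₁ d₂ : Atom)
      (cd₁d₁ : Allowed c d₁ d₁) (ccd₁̸ : ¬ Allowed c c d₁)
      (cd₂d₂ : Allowed c d₂ d₂) (ccd₂̸ : ¬ Allowed c c d₂)
      (d₁d₂d₁̸ : ¬ Allowed d₁ d₂ d₁) (d₁d₂d₂̸ : ¬ Allowed d₁ d₂ d₂) where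
      open Incompatible c d₁ d₂ cd₁d₁ ccd₁̸ cd₂d₂ ccd₂̸ d₁d₂d₁̸ d₁d₂d₂̸
      private
        module ₁ = SiggersPair c d₁ cd₁d₁ ccd₁̸

      ¬siggers-incompatible : ⊥
      ¬siggers-incompatible
        with ₁.hits⊎misses S₁₂ | ₁.hits⊎misses S₃₄ | ₁.hits⊎misses S₅₆
      ... | inj₁ h | _ | _ = ¬disjoint-hits S₁₂ S₃₅ refl h (₁.hits-siggersʳ true false false h)
      ... | _ | inj₁ h | _ = ¬disjoint-hits S₃₄ S₁₆ refl h (₁.hits-siggersʳ false true false h)
      ... | _ | _ | inj₁ h = ¬disjoint-hits S₅₆ S₂₄ refl h (₁.hits-siggersʳ false false true h)
      ... | inj₂ m₁₂ | inj₂ m₃₄ | inj₂ m₅₆ =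
        ₁.¬misses-⊤ (₁.misses-∪ S₁₂ (S₃₄ Sub.∪ S₅₆) m₁₂
                      (₁.misses-∪ S₃₄ S₅₆ m₃₄ m₅₆))

    ¬aab⇒abb : ∀ a b → ¬ Allowed a a b → Allowed a b b
    ¬aab⇒abb a b aab̸ with Allowed? a b b
    ... | yes abb = abb
    ... | no abb̸ = ⊥-elim (¬siggers-incompatible (idAtom a) a b
          (Allowed-idˡ a a) (¬Allowed-id-id a a a≉id)
          (Allowed-idˡ a b) (¬Allowed-id-id a b b≉id) aba̸ abb̸)
      where
      aba̸ : ¬ Allowed a b a
      aba̸ aba = aab̸ (Allowed-rotate a b a aba)
      a≉id : ¬ a ≈ idAtom a
      a≉id a≈id = abb̸ (Allowed-cong (sym a≈id) refl refl (Allowed-idˡ a b))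
      b≉id : ¬ b ≈ idAtom a
      b≉id b≈id = aab̸ (Allowed-cong refl refl (sym b≈id) (Allowed-id-diagonal a a))

lemmaB3 : (𝐀 : RelationAlgebra) → let open RA 𝐀 in
    IsFinite → IsSymmetric → HasNormalRepresentation → HasAll1Cycles
    → AdmitsSiggersBehavior
    → (a b : Atom) → ¬ Allowed a a b
    → IsSemilatticeEdge a b × ¬ IsSemilatticeEdge b a
lemmaB3 𝐀 finite symmetric (ρ , _) cycles (s , s-siggers) a b aab̸ =
  edge , ¬aab⇒¬semilattice-edge aab̸ abb
  where
  open RA 𝐀
  open AtomOperations 𝐀
  open SymmetricRepresentation 𝐀 finite symmetric ρ
  open Polymorphisms 𝐀 finite symmetric ρ cycles
  open Siggers (λ xs → s (map canonical xs)) (canonical-siggers {s} s-siggers)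

  abb : Allowed a b b
  abb = ¬aab⇒abb a b aab̸

  open SemilatticeCase a b abb aab̸

  edge : IsSemilatticeEdge a b
  edge = (λ x y → s (map canonical (map (select x y) T₁)))
    , binary-polymorphism (canonical-congruent s) T₁
    , hits-T₁ , hits-T₂ , select-idempotent b T₁ , select-idempotent a T₁
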